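{- Let $G$ be a finite, simple, connected graph and let $u,v$ be a good pair in $G$. Then for every vertex $c\in I(u,v)\setminus\{u,v\}$ (i.e. every common neighbour $c$ of $u$ and $v$), $\overline{cu}=\overline{cv}$.
   Context: $d_G$ is the shortest-path distance. A vertex $z$ is between $u$ and $v$ if $d_G(u,v)=d_G(u,z)+d_G(z,v)$; $I(u,v)$ is the set of vertices between $u$ and $v$. For distinct vertices $u,v$, the line $\overline{uv}$ is the set of all vertices $z$ such that one of $u,v,z$ is between the other two. A good pair is a pair of vertices $u,v$ with $d_G(u,v)=2$ such that some common neighbour $c$ of $u$ and $v$ satisfies $\overline{uc}=\overline{cv}$. -}

module Defs where

open import Level using (0ℓ)
open import Data.Nat using (ℕ; zero; suc; _+_; _≤_)
open import Data.Fin using (Fin)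
open import Data.Product using (Σ; ∃; _×_; _,_)
open import Data.Sum using (_⊎_)
open import Relation.Nullary using (¬_; Dec)
open import Relation.Binary.PropositionalEquality using (_≡_)
open import Function.Bundles using (_⇔_)

record Graph : Set₁ where
  field
    n      : ℕ
    Adj    : Fin n → Fin n → Set
    adj?   : ∀ x y → Dec (Adj x y)
    sym    : ∀ {x y} → Adj x y → Adj y x
    irrefl : ∀ {x} → ¬ Adj x x

module _ (G : Graph) where
  open Graph G

  Vertex : Set
  Vertex = Fin n

  data Walk : Vertex → Vertex → ℕ → Set where
    [] : ∀ {x} → Walk x x zero
    _∷_ : ∀ {x y z k} → Adj x y → Walk y z k → Walk x z (suc k)

  Connected : Set
  Connected = ∀ x y → ∃ λ k → Walk x y k

  Dist : Vertex → Vertex → ℕ → Set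
  Dist x y k = Walk x y k × (∀ m → Walk x y m → k ≤ m)

  Between : Vertex → Vertex → Vertex → Set
  Between x z y = Σ ℕ λ a → Σ ℕ λ b → Σ ℕ λ c →
    Dist x y a × Dist x z b × Dist z y c × a ≡ b + c

  InInterval : Vertex → Vertex → Vertex → Set
  InInterval x y z = Between x z y

  OnLine : Vertex → Vertex → Vertex → Set
  OnLine x y z = Between x z y ⊎ Between z x y ⊎ Between x y z

  SameLine : Vertex → Vertex → Vertex → Vertex → Set
  SameLine x y x' y' = ∀ z → OnLine x y z ⇔ OnLine x' y' z

  GoodPair : Vertex → Vertex → Set
  GoodPair u v = Dist u v 2 ×
    (Σ Vertex λ c → Adj u c × Adj c v × SameLine u c c v)

module Submission where

-- For an edge xy, a vertex z lies on the line xy exactly when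
-- z is NOT equidistant from x and y: the distances d(z,x), d(z,y) differ by
-- at most one, they cannot be equal for z between x and y (1 is odd), and
-- when they differ by one the farther endpoint is separated from z by the
-- nearer one.  Hence two edges span the same line iff they have the same
-- equidistant vertices.
--
-- Now let u, c₀, v witness the good pair and let c be any vertex of I(u,v)
-- other than u, v; as d(u,v) = 2, c is a common neighbour of u and v.  Fix z
-- and write a, b, p, e for its distances to u, v, c₀, c.  The good pair says
-- a = p ⇔ p = b, and every pair among (a,p), (p,b), (e,a), (e,b) differs by
-- at most one.  A purely arithmetic fact (three pairwise-distinct naturals
-- cannot pairwise differ by at most one) then forces e = a ⇔ e = b, i.e.
-- the lines cu and cv have the same equidistant vertices.

open import Defs
open import Relation.Nullary using (¬_; Dec; yes; no)
open import Relation.Binary.PropositionalEquality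
  using (_≡_; refl; sym; trans; cong; cong₂; module ≡-Reasoning)
open import Relation.Nullary.Negation using (contraposition)
open import Relation.Nullary.Decidable using (_×-dec_; decidable-stable)
open import Data.Nat using (ℕ; zero; suc; _+_; _≤_; _<_; s≤s; z≤n)
open import Data.Nat.Properties
  using (_≟_; ≤-antisym; m≤n⇒m<n∨m≡n; 1+n≰n; 1+n≢n; 0≢1+n; suc-injective; +-suc; +-comm;
         anyUpTo?; ≮⇒≥)
open import Data.Nat.Induction using (<-rec)
import Data.Fin as Fin
open import Data.Fin.Properties using (any?)
open import Data.Product using (∃; _×_; _,_; proj₁; proj₂)
open import Data.Sum using (_⊎_; inj₁; inj₂)
open import Data.Empty using (⊥; ⊥-elim)
open import Function.Bundles using (_⇔_; mk⇔; module Equivalence)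

Near : ℕ → ℕ → Set
Near a b = a ≤ suc b × b ≤ suc a

near-sym : ∀ {a b} → Near a b → Near b a
near-sym (a≤1+b , b≤1+a) = b≤1+a , a≤1+b

near-cases : ∀ {a b} → Near a b → a ≡ b ⊎ a ≡ suc b ⊎ b ≡ suc a
near-cases (a≤1+b , b≤1+a) with m≤n⇒m<n∨m≡n a≤1+b | m≤n⇒m<n∨m≡n b≤1+a
... | inj₂ a≡1+b     | _              = inj₂ (inj₁ a≡1+b)
... | inj₁ _         | inj₂ b≡1+a     = inj₂ (inj₂ b≡1+a)
... | inj₁ (s≤s a≤b) | inj₁ (s≤s b≤a) = inj₁ (≤-antisym a≤b b≤a)

no-three-near : ∀ {a b c} → Near a b → Near c b → Near a c →
                ¬ a ≡ b → ¬ c ≡ b → ¬ a ≡ c → ⊥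
no-three-near {a} {b} {c} a~b c~b (a≤1+c , c≤1+a) a≢b c≢b a≢c
  with near-cases a~b | near-cases c~b
... | inj₁ a≡b         | _                = a≢b a≡b
... | _                | inj₁ c≡b         = c≢b c≡b
... | inj₂ (inj₁ refl) | inj₂ (inj₁ refl) = a≢c refl
... | inj₂ (inj₁ refl) | inj₂ (inj₂ refl) = 1+n≰n a≤1+c
... | inj₂ (inj₂ refl) | inj₂ (inj₁ refl) = 1+n≰n c≤1+a
... | inj₂ (inj₂ refl) | inj₂ (inj₂ b≡1+c) = a≢c (suc-injective b≡1+c)

equal-transfer : ∀ {a b p e} → Near p a → Near p b → Near e b →
                 (p ≡ a → p ≡ b) → (p ≡ b → p ≡ a) → e ≡ a → e ≡ b
equal-transfer {a} {b} {p} p~a p~b e~b p≡a⇒p≡b p≡b⇒p≡a refl with p ≟ a | a ≟ b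
... | yes p≡a | _       = trans (sym p≡a) (p≡a⇒p≡b p≡a)
... | no _    | yes a≡b = a≡b
... | no p≢a  | no a≢b  =
  ⊥-elim (no-three-near (near-sym p~a) (near-sym p~b) e~b
                        (λ a≡p → p≢a (sym a≡p)) (λ b≡p → p≢b (sym b≡p)) a≢b)
  where
  p≢b : ¬ p ≡ b
  p≢b = contraposition p≡b⇒p≡a p≢a

-- The arithmetic heart of the theorem (a, b, p, e will be the distances from
-- z to u, v, c₀, c): if p is near a and b and p = a ⇔ p = b, then any e near
-- both a and b satisfies e = a ⇔ e = b.
equidistance-transfer : ∀ {a b p e} → Near a p → Near p b → Near e a → Near e b →
                        (a ≡ p ⇔ p ≡ b) → (e ≡ a ⇔ e ≡ b)
equidistance-transfer {a} {b} {p} a~p p~b e~a e~b a≡p⇔p≡b =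
  mk⇔ (equal-transfer (near-sym a~p) p~b e~b p≡a⇒p≡b p≡b⇒p≡a)
      (equal-transfer p~b (near-sym a~p) e~a p≡b⇒p≡a p≡a⇒p≡b)
  where
  open Equivalence a≡p⇔p≡b
  p≡a⇒p≡b : p ≡ a → p ≡ b
  p≡a⇒p≡b p≡a = to (sym p≡a)
  p≡b⇒p≡a : p ≡ b → p ≡ a
  p≡b⇒p≡a p≡b = sym (from p≡b)

1≢n+n : ∀ n → ¬ 1 ≡ n + n
1≢n+n zero    ()
1≢n+n (suc n) 1≡n+n = 0≢1+n (trans (suc-injective 1≡n+n) (+-suc n n))

module Walks (G : Graph) where
  open Graph G renaming (sym to adj-sym)

  snoc : ∀ {x y w k} → Walk G x y k → Adj y w → Walk G x w (suc k)
  snoc []      y~w = y~w ∷ []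
  snoc (e ∷ p) y~w = e ∷ snoc p y~w

  reverse : ∀ {x y k} → Walk G x y k → Walk G y x k
  reverse []      = []
  reverse (e ∷ p) = snoc (reverse p) (adj-sym e)

  walk? : ∀ k x y → Dec (Walk G x y k)
  walk? zero x y with x Fin.≟ y
  ... | yes refl = yes []
  ... | no x≢y   = no λ { [] → x≢y refl }
  walk? (suc k) x y with any? (λ w → adj? x w ×-dec walk? k w y)
  ... | yes (w , x~w , p) = yes (x~w ∷ p)
  ... | no none           = no λ { (x~w ∷ p) → none (_ , x~w , p) }

  shortest : ∀ {x y} m → Walk G x y m → ∃ (Dist G x y)
  shortest {x} {y} = <-rec (λ m → Walk G x y m → ∃ (Dist G x y)) step
    where
    step : ∀ m → (∀ {j} → j < m → Walk G x y j → ∃ (Dist G x y)) →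
           Walk G x y m → ∃ (Dist G x y)
    step m shorten w with anyUpTo? (λ j → walk? j x y) m
    ... | yes (j , j<m , w′) = shorten j<m w′
    ... | no none-shorter    =
      m , w , λ k w′ → ≮⇒≥ (λ k<m → none-shorter (k , k<m , w′))

  edges-of-length-two : ∀ {x y z b c} → Walk G x y b → Walk G y z c → 2 ≡ b + c →
                        ¬ y ≡ x → ¬ y ≡ z → Adj x y × Adj y z
  edges-of-length-two []         _             _  y≢x _   = ⊥-elim (y≢x refl)
  edges-of-length-two (_ ∷ _)    []            _  _   y≢z = ⊥-elim (y≢z refl)
  edges-of-length-two (x~y ∷ []) (y~z ∷ [])    _  _   _   = x~y , y~z
  edges-of-length-two (_ ∷ [])   (_ ∷ (_ ∷ _)) () _   _
  edges-of-length-two {b = suc (suc k)} {c = suc c} (_ ∷ (_ ∷ _)) (_ ∷ _) 2≡b+c _ _ =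
    ⊥-elim (0≢1+n (trans (suc-injective (suc-injective 2≡b+c)) (+-suc k c)))

module Distance (G : Graph) (connected : Connected G) where
  open Graph G renaming (sym to adj-sym)
  open Walks G
  open ≡-Reasoning

  dist : Vertex G → Vertex G → ℕ
  dist x y = proj₁ (shortest _ (proj₂ (connected x y)))

  dist-is-distance : ∀ x y → Dist G x y (dist x y)
  dist-is-distance x y = proj₂ (shortest _ (proj₂ (connected x y)))

  Dist-unique : ∀ {x y a b} → Dist G x y a → Dist G x y b → a ≡ b
  Dist-unique (wa , a-least) (wb , b-least) = ≤-antisym (a-least _ wb) (b-least _ wa)

  dist-sym : ∀ x y → dist x y ≡ dist y x
  dist-sym x y with dist-is-distance y x
  ... | w , least = Dist-unique (dist-is-distance x y) (reverse w , λ m w′ → least m (reverse w′))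

  between⇒additive : ∀ {x z y} → Between G x z y → dist x y ≡ dist x z + dist z y
  between⇒additive {x} {z} {y} (a , b , c , xy-a , xz-b , zy-c , a≡b+c) = begin
    dist x y            ≡⟨ Dist-unique (dist-is-distance _ _) xy-a ⟩
    a                   ≡⟨ a≡b+c ⟩
    b + c               ≡⟨ cong₂ _+_ (Dist-unique xz-b (dist-is-distance _ _))
                                     (Dist-unique zy-c (dist-is-distance _ _)) ⟩
    dist x z + dist z y ∎

  additive⇒between : ∀ {x z y} → dist x y ≡ dist x z + dist z y → Between G x z y
  additive⇒between additive =
    _ , _ , _ , dist-is-distance _ _ , dist-is-distance _ _ , dist-is-distance _ _ , additive

  dist-step : ∀ {z y w} → Adj y w → dist z w ≤ suc (dist z y)
  dist-step y~w = proj₂ (dist-is-distance _ _) _ (snoc (proj₁ (dist-is-distance _ _)) y~w)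

  dist-edge : ∀ {x y} → Adj x y → dist x y ≡ 1
  dist-edge {x} {y} x~y = Dist-unique (dist-is-distance x y) ((x~y ∷ []) , at-least-one)
    where
    at-least-one : ∀ m → Walk G x y m → 1 ≤ m
    at-least-one zero    []  = ⊥-elim (irrefl x~y)
    at-least-one (suc m) _   = s≤s z≤n

  near-edge : ∀ {x y} → Adj x y → ∀ z → Near (dist z x) (dist z y)
  near-edge x~y z = dist-step (adj-sym x~y) , dist-step x~y

  Equidistant : Vertex G → Vertex G → Vertex G → Set
  Equidistant z x y = dist z x ≡ dist z y

  between-edge⇒¬equidistant : ∀ {x y z} → Adj x y → Between G x z y → ¬ Equidistant z x y
  between-edge⇒¬equidistant {x} {y} {z} x~y xzy zx≡zy = 1≢n+n (dist z y) (begin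
    1                   ≡⟨ sym (dist-edge x~y) ⟩
    dist x y            ≡⟨ between⇒additive xzy ⟩
    dist x z + dist z y ≡⟨ cong (_+ dist z y) (trans (dist-sym x z) zx≡zy) ⟩
    dist z y + dist z y ∎)

  beyond-first⇒¬equidistant : ∀ {x y z} → Adj x y → Between G z x y → ¬ Equidistant z x y
  beyond-first⇒¬equidistant {x} {y} {z} x~y zxy zx≡zy = 1+n≢n (begin
    suc (dist z y)      ≡⟨ cong suc (sym zx≡zy) ⟩
    suc (dist z x)      ≡⟨ +-comm 1 (dist z x) ⟩
    dist z x + 1        ≡⟨ cong (dist z x +_) (sym (dist-edge x~y)) ⟩
    dist z x + dist x y ≡⟨ sym (between⇒additive zxy) ⟩
    dist z y            ∎)

  beyond-second⇒¬equidistant : ∀ {x y z} → Adj x y → Between G x y z → ¬ Equidistant z x y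
  beyond-second⇒¬equidistant {x} {y} {z} x~y xyz zx≡zy = 1+n≢n (begin
    suc (dist z y)      ≡⟨ cong₂ _+_ (sym (dist-edge x~y)) (dist-sym z y) ⟩
    dist x y + dist y z ≡⟨ sym (between⇒additive xyz) ⟩
    dist x z            ≡⟨ dist-sym x z ⟩
    dist z x            ≡⟨ zx≡zy ⟩
    dist z y            ∎)

  -- The line of an edge xy consists exactly of the vertices not equidistant
  -- from x and y; the converse direction uses that the two distances are near.
  on-line⇔¬equidistant : ∀ {x y} → Adj x y → ∀ z → OnLine G x y z ⇔ (¬ Equidistant z x y)
  on-line⇔¬equidistant {x} {y} x~y z = mk⇔ on-line⇒ ⇒on-line
    where
    on-line⇒ : OnLine G x y z → ¬ Equidistant z x y
    on-line⇒ (inj₁ xzy)        = between-edge⇒¬equidistant x~y xzy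
    on-line⇒ (inj₂ (inj₁ zxy)) = beyond-first⇒¬equidistant x~y zxy
    on-line⇒ (inj₂ (inj₂ xyz)) = beyond-second⇒¬equidistant x~y xyz

    ⇒on-line : ¬ Equidistant z x y → OnLine G x y z
    ⇒on-line zx≢zy with near-cases (near-edge x~y z)
    ... | inj₁ zx≡zy           = ⊥-elim (zx≢zy zx≡zy)
    ... | inj₂ (inj₁ zx≡1+zy) = inj₂ (inj₂ (additive⇒between (begin
      dist x z            ≡⟨ dist-sym x z ⟩
      dist z x            ≡⟨ zx≡1+zy ⟩
      suc (dist z y)      ≡⟨ cong₂ _+_ (sym (dist-edge x~y)) (dist-sym z y) ⟩
      dist x y + dist y z ∎)))
    ... | inj₂ (inj₂ zy≡1+zx) = inj₂ (inj₁ (additive⇒between (begin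
      dist z y            ≡⟨ zy≡1+zx ⟩
      suc (dist z x)      ≡⟨ +-comm 1 (dist z x) ⟩
      dist z x + 1        ≡⟨ cong (dist z x +_) (sym (dist-edge x~y)) ⟩
      dist z x + dist x y ∎)))

  equidistance-along : ∀ {x y x′ y′} → Adj x y → Adj x′ y′ → ∀ z →
                       (OnLine G x′ y′ z → OnLine G x y z) →
                       Equidistant z x y → Equidistant z x′ y′
  equidistance-along x~y x′~y′ z line′⇒line zx≡zy =
    decidable-stable (_ ≟ _) λ zx′≢zy′ → line⇒ (line′⇒line (⇒line′ zx′≢zy′)) zx≡zy
    where
    open Equivalence (on-line⇔¬equidistant x~y z) using () renaming (to to line⇒)
    open Equivalence (on-line⇔¬equidistant x′~y′ z) using () renaming (from to ⇒line′)

  same-line⇒same-equidistant : ∀ {x y x′ y′} → Adj x y → Adj x′ y′ →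
                               SameLine G x y x′ y′ → ∀ z → Equidistant z x y ⇔ Equidistant z x′ y′
  same-line⇒same-equidistant x~y x′~y′ same z =
    mk⇔ (equidistance-along x~y x′~y′ z (Equivalence.from (same z)))
        (equidistance-along x′~y′ x~y z (Equivalence.to (same z)))

  same-equidistant⇒same-line : ∀ {x y x′ y′} → Adj x y → Adj x′ y′ →
                               (∀ z → Equidistant z x y ⇔ Equidistant z x′ y′) → SameLine G x y x′ y′
  same-equidistant⇒same-line x~y x′~y′ same z =
    mk⇔ (λ on  → ⇒line′ (contraposition (Equivalence.from (same z)) (line⇒ on)))
        (λ on′ → ⇒line  (contraposition (Equivalence.to (same z)) (line′⇒ on′)))
    where
    open Equivalence (on-line⇔¬equidistant x~y z) using () renaming (to to line⇒; from to ⇒line)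
    open Equivalence (on-line⇔¬equidistant x′~y′ z) using () renaming (to to line′⇒; from to ⇒line′)

  interval-common-neighbour : ∀ {u v c} → Dist G u v 2 → InInterval G u v c →
                              ¬ c ≡ u → ¬ c ≡ v → Adj u c × Adj c v
  interval-common-neighbour uv-2 (a , b , c , uv-a , (uc , _) , (cv , _) , a≡b+c) =
    edges-of-length-two uc cv (trans (Dist-unique uv-2 uv-a) a≡b+c)

lemma2 : (G : Graph) → Connected G →
         (u v : Vertex G) → GoodPair G u v →
         (c : Vertex G) → InInterval G u v c → ¬ c ≡ u → ¬ c ≡ v →
         SameLine G c u c v
lemma2 G connected u v (uv-2 , c₀ , u~c₀ , c₀~v , uc₀=c₀v) c c∈I c≢u c≢v =
  same-equidistant⇒same-line c~u c~v λ z →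
    equidistance-transfer (near-edge u~c₀ z) (near-edge c₀~v z)
                          (near-edge c~u z) (near-edge c~v z)
                          (same-line⇒same-equidistant u~c₀ c₀~v uc₀=c₀v z)
  where
  open Graph G using (Adj) renaming (sym to adj-sym)
  open Distance G connected

  u~c×c~v : Adj u c × Adj c v
  u~c×c~v = interval-common-neighbour uv-2 c∈I c≢u c≢v

  c~u : Adj c u
  c~u = adj-sym (proj₁ u~c×c~v)

  c~v : Adj c v
  c~v = proj₂ u~c×c~v
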